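{- Let $(V,\mathcal{C})$ be an instance of 3-Compatible Colouring with colours $\{\mathcal{X},\mathcal{Y},\mathcal{Z}\}$ (three distinct colours), and let $S \subseteq V$. Let $(V',\mathcal{C}')$ be obtained by adding four new vertices $v_1,v_2,v_3,v_4$ with $\mathcal{C}'(v_1v_2)=\mathcal{C}'(v_3v_4)=\mathcal{Y}$, $\mathcal{C}'(v_1v_3)=\mathcal{C}'(v_1v_4)=\mathcal{C}'(v_2v_3)=\mathcal{C}'(v_2v_4)=\mathcal{Z}$, and for every $v \in V$ and $i \in \{1,2,3,4\}$, $\mathcal{C}'(v_iv)=\mathcal{X}$ if $v \in S$ and $\mathcal{C}'(v_iv)=\mathcal{Y}$ if $v \in V\setminus S$ (edges within $V$ keep their colours). Then $(V',\mathcal{C}')$ has a feasible colouring if and only if $(V,\mathcal{C})$ has a feasible colouring $\phi$ with $\phi^{ -1}(\mathcal{X}) \cap S = \emptyset$.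
   Context: An instance of 3-Compatible Colouring is a finite vertex set $V$ with a colouring $\mathcal{C}$ of all edges of the complete graph on $V$ with three colours; a feasible colouring is a map $\phi$ from $V$ to the three colours such that no edge $uv$ satisfies $\phi(u)=\phi(v)=\mathcal{C}(uv)$. -}

module Defs where

open import Data.Nat using (ℕ)
open import Data.Fin using (Fin; zero; suc)
open import Data.Fin.Subset using (Subset; _∈_)
open import Data.Fin.Subset.Properties using (_∈?_)
open import Data.Sum using (_⊎_; inj₁; inj₂)
open import Data.Product using (_×_)
open import Relation.Binary.PropositionalEquality using (_≡_)
open import Relation.Nullary using (¬_; yes; no)

data Colour : Set where
  𝒳 𝒴 𝒵 : Colour

-- An instance of 3-Compatible Colouring on a finite vertex type V:
-- a colouring of all edges of the complete graph on V, represented as a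
-- symmetric function on pairs (its values on the diagonal are irrelevant).
record Instance (V : Set) : Set where
  field
    col : V → V → Colour
    sym : ∀ u v → col u v ≡ col v u

Feasible : {V : Set} → (V → V → Colour) → (V → Colour) → Set
Feasible {V} C φ = ∀ (u v : V) → ¬ (u ≡ v) → ¬ ((φ u ≡ C u v) × (φ v ≡ C u v))

-- Colours among the four new vertices v₁ v₂ v₃ v₄ (= Fin 4: 0,1,2,3).
gadget : Fin 4 → Fin 4 → Colour
gadget zero (suc zero) = 𝒴
gadget (suc zero) zero = 𝒴
gadget (suc (suc zero)) (suc (suc (suc zero))) = 𝒴
gadget (suc (suc (suc zero))) (suc (suc zero)) = 𝒴
gadget _ _ = 𝒵   -- v₁v₃, v₁v₄, v₂v₃, v₂v₄ (and irrelevant diagonal)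

attach : {n : ℕ} → Subset n → Fin n → Colour
attach S v with v ∈? S
... | yes _ = 𝒳
... | no _ = 𝒴

extend : {n : ℕ} → (Fin n → Fin n → Colour) → Subset n →
         (Fin 4 ⊎ Fin n) → (Fin 4 ⊎ Fin n) → Colour
extend C S (inj₁ i) (inj₁ j) = gadget i j
extend C S (inj₁ i) (inj₂ v) = attach S v
extend C S (inj₂ v) (inj₁ i) = attach S v
extend C S (inj₂ u) (inj₂ v) = C u v

-- In a feasible colouring of the gadget some vᵢ is coloured 𝒳: otherwise each
-- 𝒴-edge v₁v₂, v₃v₄ has an endpoint coloured 𝒵, and these two endpoints are
-- joined by a 𝒵-edge. That vᵢ is joined to every vertex of S by an 𝒳-edge, so
-- no vertex of S is coloured 𝒳. Conversely, colour all of v₁,…,v₄ with 𝒳: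
-- gadget edges are never 𝒳, and 𝒳-edges to V end in S, where φ avoids 𝒳.
module Submission where

open import Defs
open import Data.Nat using (ℕ)
open import Data.Fin using (Fin; zero; suc; #_)
open import Data.Fin.Properties using (any?)
open import Data.Fin.Subset using (Subset; _∈_)
open import Data.Fin.Subset.Properties using (_∈?_)
open import Data.Sum using (_⊎_; inj₁; inj₂; [_,_]′)
open import Data.Sum.Properties using (inj₁-injective; inj₂-injective)
open import Data.Product using (_×_; _,_; ∃-syntax)
open import Data.Empty using (⊥; ⊥-elim)
open import Function.Base using (_∘_; const)
open import Function.Definitions using (Injective)
open import Function.Bundles using (_⇔_; mk⇔)
open import Relation.Binary.PropositionalEquality using (_≡_; _≢_; refl; sym; trans; cong)
open import Relation.Nullary using (¬_; Dec; yes; no)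
open import Relation.Nullary.Decidable using (decidable-stable)

feasible-∘ : {U V : Set} {C : V → V → Colour} {ψ : V → Colour} {f : U → V} →
  Injective _≡_ _≡_ f → Feasible C ψ → Feasible (λ u v → C (f u) (f v)) (ψ ∘ f)
feasible-∘ f-inj feasible u v u≢v = feasible _ _ (u≢v ∘ f-inj)

some-𝒵 : ∀ {a b} → a ≢ 𝒳 → b ≢ 𝒳 → ¬ (a ≡ 𝒴 × b ≡ 𝒴) → a ≡ 𝒵 ⊎ b ≡ 𝒵
some-𝒵 {𝒳} a≢𝒳 _ _ = ⊥-elim (a≢𝒳 refl)
some-𝒵 {_} {𝒳} _ b≢𝒳 _ = ⊥-elim (b≢𝒳 refl)
some-𝒵 {𝒵} _ _ _ = inj₁ refl
some-𝒵 {_} {𝒵} _ _ _ = inj₂ refl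
some-𝒵 {𝒴} {𝒴} _ _ not-𝒴𝒴 = ⊥-elim (not-𝒴𝒴 (refl , refl))

gadget≢𝒳 : ∀ i j → gadget i j ≢ 𝒳
gadget≢𝒳 zero zero ()
gadget≢𝒳 zero (suc zero) ()
gadget≢𝒳 zero (suc (suc j)) ()
gadget≢𝒳 (suc zero) zero ()
gadget≢𝒳 (suc zero) (suc j) ()
gadget≢𝒳 (suc (suc zero)) zero ()
gadget≢𝒳 (suc (suc zero)) (suc zero) ()
gadget≢𝒳 (suc (suc zero)) (suc (suc zero)) ()
gadget≢𝒳 (suc (suc zero)) (suc (suc (suc zero))) ()
gadget≢𝒳 (suc (suc (suc zero))) zero ()
gadget≢𝒳 (suc (suc (suc zero))) (suc zero) ()
gadget≢𝒳 (suc (suc (suc zero))) (suc (suc zero)) ()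
gadget≢𝒳 (suc (suc (suc zero))) (suc (suc (suc zero))) ()

_≟𝒳 : (c : Colour) → Dec (c ≡ 𝒳)
𝒳 ≟𝒳 = yes refl
𝒴 ≟𝒳 = no λ ()
𝒵 ≟𝒳 = no λ ()

gadget-has-𝒳 : ∀ {χ} → Feasible gadget χ → ∃[ i ] χ i ≡ 𝒳
gadget-has-𝒳 {χ} feasible = decidable-stable (any? (_≟𝒳 ∘ χ))
  λ no-𝒳 → 𝒳-free-impossible (λ i χi≡𝒳 → no-𝒳 (i , χi≡𝒳))
  where
  𝒳-free-impossible : (∀ i → χ i ≢ 𝒳) → ⊥
  𝒳-free-impossible χ≢𝒳
    with some-𝒵 (χ≢𝒳 (# 0)) (χ≢𝒳 (# 1)) (feasible (# 0) (# 1) λ ())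
       | some-𝒵 (χ≢𝒳 (# 2)) (χ≢𝒳 (# 3)) (feasible (# 2) (# 3) λ ())
  ... | inj₁ χ₀≡𝒵 | inj₁ χ₂≡𝒵 = feasible (# 0) (# 2) (λ ()) (χ₀≡𝒵 , χ₂≡𝒵)
  ... | inj₁ χ₀≡𝒵 | inj₂ χ₃≡𝒵 = feasible (# 0) (# 3) (λ ()) (χ₀≡𝒵 , χ₃≡𝒵)
  ... | inj₂ χ₁≡𝒵 | inj₁ χ₂≡𝒵 = feasible (# 1) (# 2) (λ ()) (χ₁≡𝒵 , χ₂≡𝒵)
  ... | inj₂ χ₁≡𝒵 | inj₂ χ₃≡𝒵 = feasible (# 1) (# 3) (λ ()) (χ₁≡𝒵 , χ₃≡𝒵)

attach-∈ : ∀ {n} {S : Subset n} {v} → v ∈ S → attach S v ≡ 𝒳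
attach-∈ {S = S} {v} v∈S with v ∈? S
... | yes _ = refl
... | no v∉S = ⊥-elim (v∉S v∈S)

module _ {n : ℕ} (C : Fin n → Fin n → Colour) (S : Subset n) where

  extend-feasible⇒S-avoids-𝒳 : ∀ {ψ} → Feasible (extend C S) ψ →
    ∀ v → v ∈ S → ψ (inj₂ v) ≢ 𝒳
  extend-feasible⇒S-avoids-𝒳 {ψ} feasible v v∈S ψv≡𝒳
    with gadget-has-𝒳 (feasible-∘ inj₁-injective feasible)
  ... | i , ψi≡𝒳 = feasible (inj₁ i) (inj₂ v) (λ ()) (trans ψi≡𝒳 𝒳≡edge , trans ψv≡𝒳 𝒳≡edge)
    where
    𝒳≡edge : 𝒳 ≡ attach S v
    𝒳≡edge = sym (attach-∈ v∈S)

  S-avoids-𝒳⇒extend-feasible : ∀ {φ} → Feasible C φ → (∀ v → v ∈ S → φ v ≢ 𝒳) →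
    Feasible (extend C S) [ const 𝒳 , φ ]′
  S-avoids-𝒳⇒extend-feasible {φ} feasible S-avoids-𝒳 = λ where
      (inj₁ i) (inj₁ j) _ (𝒳≡gadget , _) → gadget≢𝒳 i j (sym 𝒳≡gadget)
      (inj₁ _) (inj₂ v) _ (𝒳≡edge , φv≡edge) → hub-edge v 𝒳≡edge φv≡edge
      (inj₂ v) (inj₁ _) _ (φv≡edge , 𝒳≡edge) → hub-edge v 𝒳≡edge φv≡edge
      (inj₂ u) (inj₂ v) u≢v → feasible u v (u≢v ∘ cong inj₂)
    where
    hub-edge : ∀ v → 𝒳 ≡ attach S v → φ v ≢ attach S v
    hub-edge v with v ∈? S
    ... | yes v∈S = λ _ → S-avoids-𝒳 v v∈S
    ... | no _    = λ ()

mainTheorem6 : (n : ℕ) (I : Instance (Fin n)) (S : Subset n) →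
    (∃[ ψ ] Feasible (extend (Instance.col I) S) ψ)
    ⇔ (∃[ φ ] (Feasible (Instance.col I) φ × (∀ v → v ∈ S → ¬ (φ v ≡ 𝒳))))
mainTheorem6 n I S = mk⇔
  (λ (ψ , feasible) → ψ ∘ inj₂ ,
     feasible-∘ inj₂-injective feasible , extend-feasible⇒S-avoids-𝒳 C S feasible)
  (λ (φ , feasible , S-avoids-𝒳) → [ const 𝒳 , φ ]′ ,
     S-avoids-𝒳⇒extend-feasible C S feasible S-avoids-𝒳)
  where
  C : Fin n → Fin n → Colour
  C = Instance.col I
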